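{- Let $\omega=\frac{ -1+\sqrt{ -3}}{2}$. For every rational number $\alpha$, $\mathcal{R}_\alpha(\omega)$ and $\mathcal{S}_\alpha(\omega)$ belong to $\{0,\pm1,\pm\omega,\pm\omega^2\}$.
   Context: For an integer $c$, $[c]_q=\frac{1-q^c}{1-q}$ (a Laurent polynomial). Every rational $\alpha>1$ has a unique negative continued fraction expansion $\alpha=c_1-\cfrac{1}{c_2-\cfrac{1}{\ddots-\cfrac{1}{c_l}}}$ with integers $c_j\ge 2$. Put $M^-_q(c)=\begin{pmatrix}[c]_q & -q^{c-1}\\ 1 & 0\end{pmatrix}$ and define $\mathcal{R}_\alpha(q),\mathcal{S}_\alpha(q)$ by $\begin{pmatrix}\mathcal{R}_\alpha(q)\\ \mathcal{S}_\alpha(q)\end{pmatrix}=M^-_q(c_1)\cdots M^-_q(c_l)\begin{pmatrix}1\\0\end{pmatrix}$. For rational $\alpha\le 1$ they are defined recursively by $\mathcal{S}_\alpha(q)=\mathcal{S}_{\alpha+1}(q)$ and $\mathcal{R}_\alpha(q)=q^{ -1}(\mathcal{R}_{\alpha+1}(q)-\mathcal{S}_{\alpha+1}(q))$, so they are Laurent polynomials in $q$ with integer coefficients. -}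

module Defs where

open import Data.Nat as ℕ using (ℕ; zero; suc)
open import Data.Nat.DivMod using (_/_; _%_)
open import Data.Integer as ℤ using (ℤ; +_)
open import Data.Rational using (ℚ; ↥_; ↧ₙ_)
open import Data.List using (List; []; _∷_; foldr)
open import Data.Product using (_×_; _,_; proj₁; proj₂)
open import Relation.Nullary using (does)
open import Data.Bool using (if_then_else_)
open import Function using (_∘_)

-- Eisenstein integers ℤ[ω]: the element a + b·ω, where ω² = -1 - ω.
-- Every element has a unique such representation, so ≡ is the correct
-- equality.

record ℤω : Set where
  constructor _+_ω
  field
    re : ℤ
    im : ℤ

infixl 6 _⊕_ _⊖_
infixl 7 _⊗_

_⊕_ : ℤω → ℤω → ℤω
(a + b ω) ⊕ (c + d ω) = (a ℤ.+ c) + (b ℤ.+ d) ω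

⊝_ : ℤω → ℤω
⊝ (a + b ω) = (ℤ.- a) + (ℤ.- b) ω

_⊖_ : ℤω → ℤω → ℤω
x ⊖ y = x ⊕ (⊝ y)

-- (a + bω)(c + dω) = ac + (ad + bc)ω + bd ω² = (ac - bd) + (ad + bc - bd)ω
_⊗_ : ℤω → ℤω → ℤω
(a + b ω) ⊗ (c + d ω) =
  (a ℤ.* c ℤ.- b ℤ.* d) + (a ℤ.* d ℤ.+ b ℤ.* c ℤ.- b ℤ.* d) ω

𝟘 𝟙 ω : ℤω
𝟘 = (+ 0) + (+ 0) ω
𝟙 = (+ 1) + (+ 0) ω
ω = (+ 0) + (+ 1) ω

-- ω⁻¹ = ω² = -1 - ω  (since ω³ = 1)
ω⁻¹ : ℤω
ω⁻¹ = ω ⊗ ω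

ω^ : ℕ → ℤω
ω^ zero    = 𝟙
ω^ (suc n) = ω ⊗ ω^ n

-- q-integers evaluated at q = ω, for c ≥ 0:
-- [c]_q = (1 - q^c)/(1 - q) = 1 + q + ... + q^(c-1).
-- (Only c ≥ 2 ever occurs below.)

[_]ω : ℕ → ℤω
[ zero  ]ω = 𝟘
[ suc c ]ω = 𝟙 ⊕ ω ⊗ [ c ]ω

M⁻ : ℕ → ℤω × ℤω → ℤω × ℤω
M⁻ c (x , y) = ([ c ]ω ⊗ x ⊖ ω^ (c ℕ.∸ 1) ⊗ y , x)

RSlist : List ℕ → ℤω × ℤω
RSlist cs = foldr M⁻ (𝟙 , 𝟘) cs

-- Negative continued fraction expansion of n/d with n > d ≥ 1:
--   if d ∣ n, the expansion is [n/d];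
--   otherwise c₁ = ⌊n/d⌋ + 1 ≥ 2 and n/d = c₁ - 1/(d/(c₁ d - n)),
--   where 0 < c₁ d - n < d, so we continue with d/(c₁ d - n) > 1.
-- The fuel argument is started at d; since the denominator strictly
-- decreases and stays ≥ 1, the fuel never runs out (the zero clauses
-- are unreachable from negCF).

negCF-go : ℕ → ℕ → ℕ → List ℕ
negCF-go zero    n d       = []
negCF-go (suc f) n zero    = []
negCF-go (suc f) n (suc d) =
  if does (n % suc d ℕ.≟ 0)
  then (n / suc d) ∷ []
  else (suc (n / suc d)) ∷ negCF-go f (suc d) (suc (n / suc d) ℕ.* suc d ℕ.∸ n)

negCF : ℕ → ℕ → List ℕ
negCF n d = negCF-go d n d

-- If α ≤ 1: R_α = q⁻¹ (R_{α+1} - S_{α+1}), S_α = S_{α+1}; unfolding,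
-- with k the least natural number such that α + k > 1, namely
-- k = ⌊(d - z)/d⌋ + 1, we apply this step k times starting at α + k.

shiftStep : ℤω × ℤω → ℤω × ℤω
shiftStep (r , s) = (ω⁻¹ ⊗ (r ⊖ s) , s)

iterate : ℕ → (ℤω × ℤω → ℤω × ℤω) → ℤω × ℤω → ℤω × ℤω
iterate zero    g x = x
iterate (suc k) g x = g (iterate k g x)

RSfrac : ℤ → ℕ → ℤω × ℤω
RSfrac z zero    = 𝟘 , 𝟘   -- denominator 0 never occurs
RSfrac z (suc d) =
  if does (+ suc d ℤ.<? z)
  then RSlist (negCF ℤ.∣ z ∣ (suc d))
  else iterate k shiftStep
         (RSlist (negCF ℤ.∣ z ℤ.+ (+ k) ℤ.* (+ suc d) ∣ (suc d)))
  where
    k : ℕ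
    k = ℤ.∣ + suc d ℤ.- z ∣ / suc d ℕ.+ 1

ℛ : ℚ → ℤω
ℛ α = proj₁ (RSfrac (↥ α) (↧ₙ α))

𝒮 : ℚ → ℤω
𝒮 α = proj₂ (RSfrac (↥ α) (↧ₙ α))

sixthRootsOrZero : List ℤω
sixthRootsOrZero =
  𝟘 ∷ 𝟙 ∷ ⊝ 𝟙 ∷ ω ∷ ⊝ ω ∷ ω ⊗ ω ∷ ⊝ (ω ⊗ ω) ∷ []

-- At q = ω the matrix M⁻_q(c) depends only on c mod 3, since both [c]_ω and
-- ω^(c-1) are 3-periodic in c. The orbit of (1, 0) under the three resulting
-- matrices and under the step α ↦ α - 1 consists of the 24 pairs (u, 0),
-- (0, u), (u, u) and ((1 + ω) u, u) with u a unit of ℤ[ω], all of whose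
-- entries are 0 or sixth roots of unity. Closure of this finite set is checked
-- by computation.

module Submission where

open import Defs
open import Data.Rational using (ℚ; ↥_)
open ℚ using (denominator-1)
open import Data.Nat as ℕ using (ℕ; zero; suc)
open import Data.Integer as ℤ using (+_)
open import Data.Bool using (true; false)
open import Data.List using (List; []; _∷_; concatMap)
open import Data.List.Relation.Unary.All as All using (All; all?)
import Data.List.Membership.DecPropositional as DecMembership
open import Data.List.Membership.Propositional using (_∈_)
open import Data.Product using (_×_; _,_; proj₁; proj₂)
open import Data.Product.Properties using (≡-dec)
open import Relation.Binary.Definitions using (DecidableEquality)
open import Relation.Binary.PropositionalEquality using (refl)
open import Relation.Nullary using (yes; no; does)
open import Relation.Nullary.Decidable using (from-yes; _×-dec_)

_≟ω_ : DecidableEquality ℤω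
(a + b ω) ≟ω (c + d ω) with a ℤ.≟ c | b ℤ.≟ d
... | yes refl | yes refl = yes refl
... | no a≢c   | _        = no λ { refl → a≢c refl }
... | yes _    | no b≢d   = no λ { refl → b≢d refl }

_≟ω²_ : DecidableEquality (ℤω × ℤω)
_≟ω²_ = ≡-dec _≟ω_ _≟ω_

open DecMembership _≟ω_  using () renaming (_∈?_ to _∈ω?_)
open DecMembership _≟ω²_ using () renaming (_∈?_ to _∈ω²?_)

units : List ℤω
units = 𝟙 ∷ ⊝ 𝟙 ∷ ω ∷ ⊝ ω ∷ ω ⊗ ω ∷ ⊝ (ω ⊗ ω) ∷ []

orbit : List (ℤω × ℤω)
orbit = concatMap (λ u → (u , 𝟘) ∷ (𝟘 , u) ∷ (u , u) ∷ ([ 2 ]ω ⊗ u , u) ∷ []) units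

orbit-sixthRootsOrZero :
  All (λ p → (proj₁ p ∈ sixthRootsOrZero) × (proj₂ p ∈ sixthRootsOrZero)) orbit
orbit-sixthRootsOrZero =
  from-yes (all? (λ p → (proj₁ p ∈ω? sixthRootsOrZero) ×-dec (proj₂ p ∈ω? sixthRootsOrZero)) orbit)

matrix : ℤω × ℤω → ℤω × ℤω → ℤω × ℤω
matrix (a , b) (x , y) = (a ⊗ x ⊖ b ⊗ y , x)

-- M⁻ (suc c) p reduces to matrix (coefficients c) p.

coefficients : ℕ → ℤω × ℤω
coefficients c = ([ suc c ]ω , ω^ c)

nextCoefficients : ℤω × ℤω → ℤω × ℤω
nextCoefficients (a , b) = (𝟙 ⊕ ω ⊗ a , ω ⊗ b)

coefficientValues : List (ℤω × ℤω)
coefficientValues = coefficients 0 ∷ coefficients 1 ∷ coefficients 2 ∷ []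

coefficients-∈ : ∀ c → coefficients c ∈ coefficientValues
coefficients-∈ zero    = from-yes (coefficients 0 ∈ω²? coefficientValues)
coefficients-∈ (suc c) = All.lookup nextCoefficients-closed (coefficients-∈ c)
  where
  nextCoefficients-closed : All (λ k → nextCoefficients k ∈ coefficientValues) coefficientValues
  nextCoefficients-closed = from-yes (all? (λ k → nextCoefficients k ∈ω²? coefficientValues) coefficientValues)

M⁻-suc-orbit : ∀ c {p} → p ∈ orbit → M⁻ (suc c) p ∈ orbit
M⁻-suc-orbit c = All.lookup (All.lookup matrix-closed (coefficients-∈ c))
  where
  matrix-closed : All (λ k → All (λ p → matrix k p ∈ orbit) orbit) coefficientValues
  matrix-closed = from-yes (all? (λ k → all? (λ p → matrix k p ∈ω²? orbit) orbit) coefficientValues)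

iterate-shiftStep-orbit : ∀ k {p} → p ∈ orbit → iterate k shiftStep p ∈ orbit
iterate-shiftStep-orbit zero    p∈ = p∈
iterate-shiftStep-orbit (suc k) p∈ = All.lookup shiftStep-closed (iterate-shiftStep-orbit k p∈)
  where
  shiftStep-closed : All (λ p → shiftStep p ∈ orbit) orbit
  shiftStep-closed = from-yes (all? (λ p → shiftStep p ∈ω²? orbit) orbit)

-- M⁻(0) does not preserve the orbit, but it only ever occurs as the last
-- entry of an expansion, where it is applied to (1, 0).

data PositiveExceptLast : List ℕ → Set where
  []      : PositiveExceptLast []
  [0]     : PositiveExceptLast (0 ∷ [])
  _∷⁺_    : ∀ {cs} c → PositiveExceptLast cs → PositiveExceptLast (suc c ∷ cs)

negCF-go-positiveExceptLast : ∀ f n d → PositiveExceptLast (negCF-go f n d)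
negCF-go-positiveExceptLast zero    n d       = []
negCF-go-positiveExceptLast (suc f) n zero    = []
negCF-go-positiveExceptLast (suc f) n (suc d) with does (n ℕ.% suc d ℕ.≟ 0)
... | false = _ ∷⁺ negCF-go-positiveExceptLast f (suc d) _
... | true with n ℕ./ suc d
...   | zero  = [0]
...   | suc c = c ∷⁺ []

RSlist-orbit : ∀ {cs} → PositiveExceptLast cs → RSlist cs ∈ orbit
RSlist-orbit []           = from-yes ((𝟙 , 𝟘) ∈ω²? orbit)
RSlist-orbit [0]          = from-yes (M⁻ 0 (𝟙 , 𝟘) ∈ω²? orbit)
RSlist-orbit (c ∷⁺ cs)  = M⁻-suc-orbit c (RSlist-orbit cs)

negCF-orbit : ∀ n d → RSlist (negCF n d) ∈ orbit
negCF-orbit n d = RSlist-orbit (negCF-go-positiveExceptLast d n d)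

RSfrac-orbit : ∀ z d → RSfrac z (suc d) ∈ orbit
RSfrac-orbit z d with does (+ suc d ℤ.<? z)
... | true  = negCF-orbit ℤ.∣ z ∣ (suc d)
... | false = iterate-shiftStep-orbit k (negCF-orbit ℤ.∣ z ℤ.+ + k ℤ.* + suc d ∣ (suc d))
  where
  k : ℕ
  k = ℤ.∣ + suc d ℤ.- z ∣ ℕ./ suc d ℕ.+ 1

theorem7p1 : (α : ℚ) → (ℛ α ∈ sixthRootsOrZero) × (𝒮 α ∈ sixthRootsOrZero)
theorem7p1 α = All.lookup orbit-sixthRootsOrZero (RSfrac-orbit (↥ α) (denominator-1 α))
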